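{- For every $n\ge 5$, $Q_n(x)=Q_{n-1}(x)+(1+x)Q_{n-2}(x)$.
   Context: For $n\ge 0$, the $S$-fence $\phi_n$ is the poset on $\{x_1,\dots,x_n\}$ whose order is generated by the cover relations $x_2<x_1$, $x_3<x_2$, $x_2<x_4$, $x_5<x_4$, and, for every $i\ge 3$, $x_{2i-1}<x_{2i}$ and $x_{2i+1}<x_{2i}$, keeping only those relations whose elements both have index $\le n$ ($\phi_0$ is empty). A filter is an up-set. $\Phi_n$ is the underlying undirected graph of the Hasse diagram of the lattice of filters of $\phi_n$ ordered by reverse inclusion (two filters adjacent iff they differ in exactly one element). $q_{n,k}$ is the number of induced subgraphs of $\Phi_n$ isomorphic to the hypercube $Q_k$, and $Q_n(x)=\sum_{k\ge0}q_{n,k}x^k$ is the cube polynomial. -}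

module Defs where

open import Data.Nat using (ℕ; zero; suc; _+_; _*_)
open import Data.Bool using (Bool; true; false)
open import Data.Fin using (Fin; toℕ)
open import Data.Fin.Subset using (Subset; _∈_)
open import Data.Vec using (Vec; []; _∷_)
open import Data.List using (List; length)
open import Data.List.Membership.Propositional using () renaming (_∈_ to _∈L_)
open import Data.List.Relation.Unary.Unique.Propositional using (Unique)
open import Data.Product using (Σ; _×_; ∃)
open import Function.Bundles using (_⇔_)
open import Function.Definitions using (Injective)
open import Relation.Binary.PropositionalEquality using (_≡_)
open import Relation.Binary.Construct.Closure.ReflexiveTransitive using (Star)

-- Cover relations of the S-fence on 1-based indices: Cov i j means x_i < x_j
-- (x_i is covered by x_j).
data Cov : ℕ → ℕ → Set where
  c21 : Cov 2 1
  c32 : Cov 3 2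
  c24 : Cov 2 4
  c54 : Cov 5 4
  -- i = t+3 ≥ 3 :  x_{2i-1} < x_{2i}   (2i-1 = 5+2t, 2i = 6+2t)
  cA  : ∀ t → Cov (5 + 2 * t) (6 + 2 * t)
  -- i = t+3 ≥ 3 :  x_{2i+1} < x_{2i}   (2i+1 = 7+2t)
  cB  : ∀ t → Cov (7 + 2 * t) (6 + 2 * t)

-- Element x_{i+1} of φ_n is represented by i : Fin n.
CovF : (n : ℕ) → Fin n → Fin n → Set
CovF n x y = Cov (suc (toℕ x)) (suc (toℕ y))

_≼[_]_ : {n : ℕ} → Fin n → (n' : ℕ) → Fin n → Set
_≼[_]_ {n} x _ y = Star (CovF n) x y

IsFilter : (n : ℕ) → Subset n → Set
IsFilter n S = ∀ (x y : Fin n) → x ≼[ n ] y → x ∈ S → y ∈ S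

hamming : {n : ℕ} → Vec Bool n → Vec Bool n → ℕ
hamming [] [] = 0
hamming (true ∷ u) (true ∷ v) = hamming u v
hamming (false ∷ u) (false ∷ v) = hamming u v
hamming (true ∷ u) (false ∷ v) = suc (hamming u v)
hamming (false ∷ u) (true ∷ v) = suc (hamming u v)

Adj : {n : ℕ} → Vec Bool n → Vec Bool n → Set
Adj u v = hamming u v ≡ 1

-- A set of subsets of {x_1..x_n}, canonically represented as a binary trie
-- (so that equal sets are equal terms).
Fam : ℕ → Set
Fam zero = Bool
Fam (suc n) = Fam n × Fam n

_∈F_ : {n : ℕ} → Subset n → Fam n → Set
[] ∈F b = b ≡ true
(false ∷ s) ∈F (l Data.Product., r) = s ∈F l
(true ∷ s) ∈F (l Data.Product., r) = s ∈F r

InducesCube : (n k : ℕ) → Fam n → Set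
InducesCube n k W =
  (∀ (S : Subset n) → S ∈F W → IsFilter n S) ×
  Σ (Vec Bool k → Subset n) λ f →
    Injective _≡_ _≡_ f ×
    (∀ v → f v ∈F W) ×
    (∀ (S : Subset n) → S ∈F W → ∃ λ v → f v ≡ S) ×
    (∀ u v → Adj u v ⇔ Adj (f u) (f v))

CubeCount : (n k c : ℕ) → Set
CubeCount n k c =
  Σ (List (Fam n)) λ L →
    Unique L × (∀ W → (W ∈L L) ⇔ InducesCube n k W) × length L ≡ c

IsCubePoly : ℕ → (ℕ → ℕ) → Set
IsCubePoly n q = ∀ k → CubeCount n k (q k)

-- coefficients of x·P(x) from those of P(x)
shiftX : (ℕ → ℕ) → ℕ → ℕ
shiftX q zero = 0
shiftX q (suc k) = q k

-- A filter of φ_n either omits or contains the last element x_n, so the vertex set of Φ_n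
-- splits into two slices according to the last coordinate. An induced hypercube of Φ_n
-- either lies in one slice, or it is a cylinder C × {0, 1} over an induced hypercube C of
-- one dimension less whose members lie in both slices: whether an edge direction of the
-- cube changes the last coordinate does not depend on the edge, since opposite edges of a
-- square of a hypercube are parallel. For n ≥ 5 the element x_n is a leaf of the fence
-- attached to x_{n-1}, and x_{n-1} is extremal in φ_{n-1} on the side opposite to x_n.
-- Hence one slice of Φ_n is a copy of Φ_{n-1}, while the other slice, which also carries
-- the bases of all cylinders, is a copy of Φ_{n-2}; counting cubes gives
-- Q_n = Q_{n-1} + Q_{n-2} + x Q_{n-2}.
module Submission where

open import Data.Bool using (Bool; true; false; not)
open import Data.Bool.Properties using (¬-not; not-¬) renaming (_≟_ to _≟ᵇ_)
open import Data.Empty using (⊥; ⊥-elim)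
open import Data.Fin using (Fin; zero; suc; fromℕ; inject₁; toℕ)
open import Data.Fin.Properties using (any?; toℕ-inject₁; toℕ-fromℕ; toℕ-injective; toℕ<n)
open import Data.Fin.Relation.Unary.Top using (view; ‵fromℕ; ‵inject₁)
open import Data.Fin.Subset using (Subset)
open import Data.List using (List; []; length; map; _++_)
open import Data.List.Membership.Propositional using () renaming (_∈_ to _∈L_)
open import Data.List.Membership.Propositional.Properties using (map-∈↔; ++-∈⇔)
open import Data.List.Membership.Propositional.Properties.WithK using (unique∧set⇒bag)
open import Data.List.Properties using (length-map; length-++)
open import Data.List.Relation.Binary.BagAndSetEquality using (∼bag⇒↭)
open import Data.List.Relation.Binary.Permutation.Propositional.Properties using (↭-length)
open import Data.List.Relation.Unary.AllPairs using ([])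
open import Data.List.Relation.Unary.Unique.Propositional using (Unique)
open import Data.List.Relation.Unary.Unique.Propositional.Properties using (map⁺; ++⁺)
open import Data.Nat using (ℕ; zero; suc; _+_; _*_; _∸_; _≤_; pred)
open import Data.Nat.Properties
  using (+-comm; +-assoc; +-identityʳ; *-suc; suc-injective; <⇒≱; n≤1+n; even≢odd; m≤n⇒∃[o]m+o≡n)
open import Data.Product using (Σ; _×_; ∃; ∃₂; _,_; proj₁; proj₂; map₁; map₂)
open import Data.Product.Function.NonDependent.Propositional using (_×-⇔_)
open import Data.Sum using (_⊎_; inj₁; inj₂)
open import Data.Sum.Function.Propositional using (_⊎-⇔_)
open import Data.Vec using (Vec; []; _∷_; _∷ʳ_; [_]; insertAt; removeAt; lookup; replicate; init; last; initLast)
open import Data.Vec.Properties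
  using ([]=⇒lookup; lookup⇒[]=; ∷ʳ-injective; ∷ʳ-injectiveˡ; init-∷ʳ; last-∷ʳ; insertAt-lookup;
         removeAt-insertAt; insertAt-removeAt)
open import Function.Base using (_∘_)
open import Function.Bundles using (_⇔_; mk⇔; Equivalence)
open import Function.Definitions using (Injective)
open import Function.Properties.Inverse using (↔⇒⇔)
import Function.Properties.Equivalence as ⇔
open import Relation.Binary.Construct.Closure.ReflexiveTransitive using (Star; ε; _◅_)
open import Relation.Binary.PropositionalEquality hiding ([_])
open import Relation.Nullary using (¬_; Dec; yes; no)
open import Relation.Nullary.Decidable using (¬?; decidable-stable)

open import Defs

open Equivalence using (to; from)

-- Families of subsets

∅ : ∀ {m} → Fam m
∅ {zero} = false
∅ {suc m} = ∅ , ∅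

∉∅ : ∀ {m} (S : Subset m) → ¬ S ∈F ∅
∉∅ [] ()
∉∅ (false ∷ S) = ∉∅ S
∉∅ (true ∷ S) = ∉∅ S

Fam-ext : ∀ {m} (A B : Fam m) → (∀ S → S ∈F A ⇔ S ∈F B) → A ≡ B
Fam-ext {zero} false false h = refl
Fam-ext {zero} true true h = refl
Fam-ext {zero} false true h = from (h []) refl
Fam-ext {zero} true false h = sym (to (h []) refl)
Fam-ext {suc m} (A , A′) (B , B′) h =
  cong₂ _,_ (Fam-ext A B (λ S → h (false ∷ S))) (Fam-ext A′ B′ (λ S → h (true ∷ S)))

-- A family in Fam (suc m) is a pair of families split by the first coordinate; slice and glue
-- split it by the last one instead.
slice : ∀ {m} → Bool → Fam (suc m) → Fam m
slice {zero} false (a , _) = a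
slice {zero} true (_ , b) = b
slice {suc m} c (W , W′) = slice c W , slice c W′

glue : ∀ {m} → Fam m → Fam m → Fam (suc m)
glue {zero} a b = a , b
glue {suc m} (A , A′) (B , B′) = glue A B , glue A′ B′

∈-slice : ∀ {m} c (W : Fam (suc m)) (s : Subset m) → s ∈F slice c W ⇔ (s ∷ʳ c) ∈F W
∈-slice false (a , b) [] = ⇔.refl
∈-slice true (a , b) [] = ⇔.refl
∈-slice c (W , W′) (false ∷ s) = ∈-slice c W s
∈-slice c (W , W′) (true ∷ s) = ∈-slice c W′ s

slice-glueˡ : ∀ {m} (A B : Fam m) → slice false (glue A B) ≡ A
slice-glueˡ {zero} a b = refl
slice-glueˡ {suc m} (A , A′) (B , B′) = cong₂ _,_ (slice-glueˡ A B) (slice-glueˡ A′ B′)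

slice-glueʳ : ∀ {m} (A B : Fam m) → slice true (glue A B) ≡ B
slice-glueʳ {zero} a b = refl
slice-glueʳ {suc m} (A , A′) (B , B′) = cong₂ _,_ (slice-glueʳ A B) (slice-glueʳ A′ B′)

glue-slice : ∀ {m} (W : Fam (suc m)) → glue (slice false W) (slice true W) ≡ W
glue-slice {zero} (a , b) = refl
glue-slice {suc m} (W , W′) = cong₂ _,_ (glue-slice W) (glue-slice W′)

embed : ∀ {m} → Bool → Fam m → Fam (suc m)
embed false A = glue A ∅
embed true A = glue ∅ A

cylinder : ∀ {m} → Fam m → Fam (suc m)
cylinder C = glue C C

slice-embed : ∀ {m} c (A : Fam m) → slice c (embed c A) ≡ A
slice-embed false A = slice-glueˡ A ∅
slice-embed true A = slice-glueʳ ∅ A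

slice-embed-≢ : ∀ {m} c l (A : Fam m) → l ≢ c → slice l (embed c A) ≡ ∅
slice-embed-≢ false true A _ = slice-glueʳ A ∅
slice-embed-≢ true false A _ = slice-glueˡ ∅ A
slice-embed-≢ false false A l≢c = ⊥-elim (l≢c refl)
slice-embed-≢ true true A l≢c = ⊥-elim (l≢c refl)

slice-cylinder : ∀ {m} c (C : Fam m) → slice c (cylinder C) ≡ C
slice-cylinder false C = slice-glueˡ C C
slice-cylinder true C = slice-glueʳ C C

embed-slice : ∀ {m} c (W : Fam (suc m)) → slice (not c) W ≡ ∅ → embed c (slice c W) ≡ W
embed-slice false W e = trans (cong (glue (slice false W)) (sym e)) (glue-slice W)
embed-slice true W e = trans (cong (λ A → glue A (slice true W)) (sym e)) (glue-slice W)

cylinder-slice : ∀ {m} (W : Fam (suc m)) → slice false W ≡ slice true W → cylinder (slice false W) ≡ W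
cylinder-slice W e = trans (cong (glue (slice false W)) e) (glue-slice W)

slice≡∅ : ∀ {m} c (W : Fam (suc m)) → (∀ s → ¬ (s ∷ʳ c) ∈F W) → slice c W ≡ ∅
slice≡∅ c W h = Fam-ext _ _ λ s →
  mk⇔ (λ p → ⊥-elim (h s (to (∈-slice c W s) p))) (λ p → ⊥-elim (∉∅ s p))

slices≡ : ∀ {m} (W : Fam (suc m)) → (∀ s c → (s ∷ʳ c) ∈F W → (s ∷ʳ not c) ∈F W) →
  slice false W ≡ slice true W
slices≡ W h = Fam-ext _ _ λ s →
  mk⇔ (λ p → from (∈-slice true W s) (h s false (to (∈-slice false W s) p)))
      (λ p → from (∈-slice false W s) (h s true (to (∈-slice true W s) p)))

embed-not≢embed : ∀ {m} c (A B : Fam m) → B ≢ ∅ → embed (not c) A ≢ embed c B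
embed-not≢embed c A B B≢∅ e = B≢∅ (begin
  B                         ≡⟨ sym (slice-embed c B) ⟩
  slice c (embed c B)       ≡⟨ cong (slice c) (sym e) ⟩
  slice c (embed (not c) A) ≡⟨ slice-embed-≢ (not c) c A (not-¬ refl) ⟩
  ∅                         ∎)
  where open ≡-Reasoning

embed≢cylinder : ∀ {m} c (A C : Fam m) → C ≢ ∅ → embed c A ≢ cylinder C
embed≢cylinder c A C C≢∅ e = C≢∅ (begin
  C                           ≡⟨ sym (slice-cylinder (not c) C) ⟩
  slice (not c) (cylinder C)  ≡⟨ cong (slice (not c)) (sym e) ⟩
  slice (not c) (embed c A)   ≡⟨ slice-embed-≢ c (not c) A (not-¬ refl ∘ sym) ⟩
  ∅                           ∎)
  where open ≡-Reasoning

∈-embed⁺ : ∀ {m} c (A : Fam m) s → s ∈F A → (s ∷ʳ c) ∈F embed c A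
∈-embed⁺ c A s p = to (∈-slice c (embed c A) s) (subst (s ∈F_) (sym (slice-embed c A)) p)

∈-embed⁻ : ∀ {m} c (A : Fam m) s l → (s ∷ʳ l) ∈F embed c A → l ≡ c × s ∈F A
∈-embed⁻ c A s l p with from (∈-slice l (embed c A) s) p | l ≟ᵇ c
... | q | yes refl = refl , subst (s ∈F_) (slice-embed c A) q
... | q | no l≢c = ⊥-elim (∉∅ s (subst (s ∈F_) (slice-embed-≢ c l A l≢c) q))

∈-cylinder : ∀ {m} (C : Fam m) s l → (s ∷ʳ l) ∈F cylinder C ⇔ s ∈F C
∈-cylinder C s l = mk⇔
  (λ p → subst (s ∈F_) (slice-cylinder l C) (from (∈-slice l (cylinder C) s) p))
  (λ p → to (∈-slice l (cylinder C) s) (subst (s ∈F_) (sym (slice-cylinder l C)) p))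

embed-injective : ∀ {m} c → Injective _≡_ _≡_ (embed {m} c)
embed-injective c {A} {B} e = trans (sym (slice-embed c A)) (trans (cong (slice c) e) (slice-embed c B))

cylinder-injective : ∀ {m} → Injective _≡_ _≡_ (cylinder {m})
cylinder-injective {x = C} {D} e =
  trans (sym (slice-cylinder false C)) (trans (cong (slice false) e) (slice-cylinder false D))

-- Hamming distance and adjacency

hamming-∷ : ∀ {n} a b (u v : Vec Bool n) → hamming (a ∷ u) (b ∷ v) ≡ hamming [ a ] [ b ] + hamming u v
hamming-∷ true true u v = refl
hamming-∷ false false u v = refl
hamming-∷ true false u v = refl
hamming-∷ false true u v = refl

hamming-refl : ∀ {n} (u : Vec Bool n) → hamming u u ≡ 0
hamming-refl [] = refl
hamming-refl (true ∷ u) = hamming-refl u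
hamming-refl (false ∷ u) = hamming-refl u

hamming-sym : ∀ {n} (u v : Vec Bool n) → hamming u v ≡ hamming v u
hamming-sym [] [] = refl
hamming-sym (true ∷ u) (true ∷ v) = hamming-sym u v
hamming-sym (false ∷ u) (false ∷ v) = hamming-sym u v
hamming-sym (true ∷ u) (false ∷ v) = cong suc (hamming-sym u v)
hamming-sym (false ∷ u) (true ∷ v) = cong suc (hamming-sym u v)

hamming≡0⇒≡ : ∀ {n} (u v : Vec Bool n) → hamming u v ≡ 0 → u ≡ v
hamming≡0⇒≡ [] [] _ = refl
hamming≡0⇒≡ (true ∷ u) (true ∷ v) h = cong (true ∷_) (hamming≡0⇒≡ u v h)
hamming≡0⇒≡ (false ∷ u) (false ∷ v) h = cong (false ∷_) (hamming≡0⇒≡ u v h)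

hamming-insertAt : ∀ {n} (u v : Vec Bool n) i a b →
  hamming (insertAt u i a) (insertAt v i b) ≡ hamming (a ∷ u) (b ∷ v)
hamming-insertAt u v zero a b = refl
hamming-insertAt (x ∷ u) (y ∷ v) (suc i) a b = begin
  hamming (x ∷ insertAt u i a) (y ∷ insertAt v i b)
    ≡⟨ hamming-∷ x y _ _ ⟩
  dx + hamming (insertAt u i a) (insertAt v i b)
    ≡⟨ cong (dx +_) (trans (hamming-insertAt u v i a b) (hamming-∷ a b u v)) ⟩
  dx + (da + hamming u v)
    ≡⟨ sym (+-assoc dx da _) ⟩
  dx + da + hamming u v
    ≡⟨ cong (_+ hamming u v) (+-comm dx da) ⟩
  da + dx + hamming u v
    ≡⟨ +-assoc da dx _ ⟩
  da + (dx + hamming u v)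
    ≡⟨ cong (da +_) (sym (hamming-∷ x y u v)) ⟩
  da + hamming (x ∷ u) (y ∷ v)
    ≡⟨ sym (hamming-∷ a b (x ∷ u) (y ∷ v)) ⟩
  hamming (a ∷ x ∷ u) (b ∷ y ∷ v) ∎
  where
    open ≡-Reasoning
    dx = hamming [ x ] [ y ]
    da = hamming [ a ] [ b ]

Adj-irrefl : ∀ {n} (u : Vec Bool n) → ¬ Adj u u
Adj-irrefl u adj with () ← trans (sym (hamming-refl u)) adj

Adj-sym : ∀ {n} (u v : Vec Bool n) → Adj u v → Adj v u
Adj-sym u v adj = trans (hamming-sym v u) adj

Adj-∷-same : ∀ {n} (a : Bool) (u v : Vec Bool n) → Adj u v ⇔ ((Adj u v × a ≡ a) ⊎ (u ≡ v × a ≢ a))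
Adj-∷-same a u v = mk⇔ (λ adj → inj₁ (adj , refl))
  λ { (inj₁ (adj , _)) → adj ; (inj₂ (_ , a≢a)) → ⊥-elim (a≢a refl) }

Adj-∷-differ : ∀ {n} {a b : Bool} (u v : Vec Bool n) → a ≢ b →
  suc (hamming u v) ≡ 1 ⇔ ((Adj u v × a ≡ b) ⊎ (u ≡ v × a ≢ b))
Adj-∷-differ u v a≢b = mk⇔
  (λ adj → inj₂ (hamming≡0⇒≡ u v (suc-injective adj) , a≢b))
  λ { (inj₁ (_ , a≡b)) → ⊥-elim (a≢b a≡b) ; (inj₂ (refl , _)) → cong suc (hamming-refl u) }

Adj-∷ : ∀ {n} a b (u v : Vec Bool n) → Adj (a ∷ u) (b ∷ v) ⇔ ((Adj u v × a ≡ b) ⊎ (u ≡ v × a ≢ b))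
Adj-∷ true true u v = Adj-∷-same true u v
Adj-∷ false false u v = Adj-∷-same false u v
Adj-∷ true false u v = Adj-∷-differ u v (λ ())
Adj-∷ false true u v = Adj-∷-differ u v (λ ())

Adj-insertAt : ∀ {n} (u v : Vec Bool n) i a b →
  Adj (insertAt u i a) (insertAt v i b) ⇔ ((Adj u v × a ≡ b) ⊎ (u ≡ v × a ≢ b))
Adj-insertAt u v i a b =
  subst (λ h → h ≡ 1 ⇔ ((Adj u v × a ≡ b) ⊎ (u ≡ v × a ≢ b))) (sym (hamming-insertAt u v i a b)) (Adj-∷ a b u v)

∷ʳ≡insertAt-fromℕ : ∀ {A : Set} {n} (u : Vec A n) a → u ∷ʳ a ≡ insertAt u (fromℕ n) a
∷ʳ≡insertAt-fromℕ [] a = refl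
∷ʳ≡insertAt-fromℕ (x ∷ u) a = cong (x ∷_) (∷ʳ≡insertAt-fromℕ u a)

Adj-∷ʳ : ∀ {n} (u v : Vec Bool n) a b →
  Adj (u ∷ʳ a) (v ∷ʳ b) ⇔ ((Adj u v × a ≡ b) ⊎ (u ≡ v × a ≢ b))
Adj-∷ʳ u v a b = subst₂ (λ x y → Adj x y ⇔ ((Adj u v × a ≡ b) ⊎ (u ≡ v × a ≢ b)))
  (sym (∷ʳ≡insertAt-fromℕ u a)) (sym (∷ʳ≡insertAt-fromℕ v b)) (Adj-insertAt u v (fromℕ _) a b)

Adj-∷ʳ-same : ∀ {n} (u v : Vec Bool n) a → Adj (u ∷ʳ a) (v ∷ʳ a) ⇔ Adj u v
Adj-∷ʳ-same u v a = ⇔.trans (Adj-∷ʳ u v a a) (⇔.sym (Adj-∷-same a u v))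

∷ʳ-init-last : ∀ {A : Set} {n} (x : Vec A (suc n)) → x ≡ init x ∷ʳ last x
∷ʳ-init-last x = proj₂ (proj₂ (initLast x))

Adj-init-last : ∀ {n} (x y : Vec Bool (suc n)) →
  Adj x y ⇔ ((Adj (init x) (init y) × last x ≡ last y) ⊎ (init x ≡ init y × last x ≢ last y))
Adj-init-last x y = subst₂
  (λ x′ y′ → Adj x′ y′ ⇔ ((Adj (init x) (init y) × last x ≡ last y) ⊎ (init x ≡ init y × last x ≢ last y)))
  (sym (∷ʳ-init-last x)) (sym (∷ʳ-init-last y)) (Adj-∷ʳ (init x) (init y) (last x) (last y))

Adj-init-last-≡ : ∀ {n} (x y : Vec Bool (suc n)) → last x ≡ last y → Adj x y ⇔ Adj (init x) (init y)
Adj-init-last-≡ x y eq = mk⇔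
  (λ adj → case-adj (to (Adj-init-last x y) adj))
  (λ adj → from (Adj-init-last x y) (inj₁ (adj , eq)))
  where
    case-adj : (Adj (init x) (init y) × last x ≡ last y) ⊎ (init x ≡ init y × last x ≢ last y) →
      Adj (init x) (init y)
    case-adj (inj₁ (adj , _)) = adj
    case-adj (inj₂ (_ , ne)) = ⊥-elim (ne eq)

Adj-init-last-≢ : ∀ {n} {x y : Vec Bool (suc n)} → Adj x y → last x ≢ last y → init x ≡ init y
Adj-init-last-≢ {x = x} {y} adj ne with to (Adj-init-last x y) adj
... | inj₁ (_ , eq) = ⊥-elim (ne eq)
... | inj₂ (eq , _) = eq

Adj⇒insertAt : ∀ {n} (u v : Vec Bool (suc n)) → Adj u v →
  ∃₂ λ w i → ∃₂ λ a b → u ≡ insertAt w i a × v ≡ insertAt w i b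
Adj⇒insertAt {n} (a ∷ u) (b ∷ v) adj with to (Adj-∷ a b u v) adj
... | inj₂ (refl , _) = u , zero , a , b , refl , refl
Adj⇒insertAt {zero} (a ∷ []) (b ∷ []) adj | inj₁ (() , _)
Adj⇒insertAt {suc n} (a ∷ u) (b ∷ v) adj | inj₁ (adj′ , refl)
  with Adj⇒insertAt u v adj′
... | w , i , x , y , refl , refl = a ∷ w , suc i , x , y , refl , refl

hypercube-connected : ∀ {k} (P : Vec Bool k → Set) → (∀ u v → Adj u v → P u → P v) →
  ∀ u v → P u → P v
hypercube-connected P step [] [] p = p
hypercube-connected P step (a ∷ u) (b ∷ v) p =
  flipHead (hypercube-connected (P ∘ (a ∷_)) stepTail u v p)
  where
    stepTail : ∀ u v → Adj u v → P (a ∷ u) → P (a ∷ v)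
    stepTail u v adj = step _ _ (from (Adj-∷ a a u v) (inj₁ (adj , refl)))
    flipHead : P (a ∷ v) → P (b ∷ v)
    flipHead with a ≟ᵇ b
    ... | yes refl = λ p → p
    ... | no a≢b = step _ _ (from (Adj-∷ a b v v) (inj₂ (refl , a≢b)))

lastFlip-unique : ∀ {n} {x y z : Vec Bool (suc n)} → Adj x y → Adj x z →
  last x ≢ last y → last x ≢ last z → y ≡ z
lastFlip-unique {x = x} {y} {z} xy xz ny nz = begin
  y                 ≡⟨ ∷ʳ-init-last y ⟩
  init y ∷ʳ last y  ≡⟨ cong₂ _∷ʳ_ (trans (sym (Adj-init-last-≢ xy ny)) (Adj-init-last-≢ xz nz))
                                  (trans (¬-not (≢-sym ny)) (sym (¬-not (≢-sym nz)))) ⟩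
  init z ∷ʳ last z  ≡⟨ sym (∷ʳ-init-last z) ⟩
  z                 ∎
  where open ≡-Reasoning

square-lastFlip : ∀ {n} {x₀ x₁ x₂ x₃ : Vec Bool (suc n)} → Adj x₀ x₁ → Adj x₁ x₂ → Adj x₀ x₃ →
  x₀ ≢ x₂ → x₁ ≢ x₃ → last x₀ ≢ last x₁ → last x₃ ≢ last x₂
square-lastFlip {x₀ = x₀} {x₁} {x₂} {x₃} x01 x12 x03 x0≢x2 x1≢x3 flip01 l3≡l2
  with last x₁ ≟ᵇ last x₂ | last x₀ ≟ᵇ last x₃
... | no l1≢l2 | _ = x0≢x2 (lastFlip-unique (Adj-sym x₀ x₁ x01) x12 (≢-sym flip01) l1≢l2)
... | yes _ | no l0≢l3 = x1≢x3 (lastFlip-unique x01 x03 flip01 l0≢l3)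
... | yes l1≡l2 | yes l0≡l3 = flip01 (trans l0≡l3 (trans l3≡l2 (sym l1≡l2)))

insertAt-injective : ∀ {A : Set} {n} (u v : Vec A n) i {a b} → insertAt u i a ≡ insertAt v i b → u ≡ v
insertAt-injective u v i {a} {b} e =
  trans (sym (removeAt-insertAt u i a)) (trans (cong (λ x → removeAt x i) e) (removeAt-insertAt v i b))

insertAt-≢ : ∀ {A : Set} {n} (u v : Vec A n) i {a b} → a ≢ b → insertAt u i a ≢ insertAt v i b
insertAt-≢ u v i {a} {b} a≢b e =
  a≢b (trans (sym (insertAt-lookup u i a)) (trans (cong (λ x → lookup x i) e) (insertAt-lookup v i b)))

Bool-fun-constant : ∀ {A : Set} (g : Bool → A) → g false ≡ g true → ∀ a b → g a ≡ g b
Bool-fun-constant g e false false = refl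
Bool-fun-constant g e true true = refl
Bool-fun-constant g e false true = e
Bool-fun-constant g e true false = sym e

-- Induced hypercubes

IsCube : ∀ {n} → ℕ → Fam n → Set
IsCube {n} k W = Σ (Vec Bool k → Subset n) λ f →
  Injective _≡_ _≡_ f × (∀ v → f v ∈F W) × (∀ S → S ∈F W → ∃ λ v → f v ≡ S) ×
  (∀ u v → Adj u v ⇔ Adj (f u) (f v))

isCube⇒≢∅ : ∀ {n k} {W : Fam n} → IsCube k W → W ≢ ∅
isCube⇒≢∅ {k = k} (f , _ , f-∈ , _) refl = ∉∅ (f (replicate k false)) (f-∈ (replicate k false))

embed-isCube : ∀ {m k} c (A : Fam m) → IsCube k A → IsCube k (embed c A)
embed-isCube c A (f , f-inj , f-∈ , f-onto , f-adj) =
  (λ v → f v ∷ʳ c) , f-inj ∘ ∷ʳ-injectiveˡ _ _ , (λ v → ∈-embed⁺ c A (f v) (f-∈ v)) , onto ,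
  λ u v → ⇔.trans (f-adj u v) (⇔.sym (Adj-∷ʳ-same (f u) (f v) c))
  where
    onto : ∀ S → S ∈F embed c A → ∃ λ v → f v ∷ʳ c ≡ S
    onto S p with initLast S
    ... | s , l , refl with ∈-embed⁻ c A s l p
    ...   | refl , s∈A = map₂ (cong (_∷ʳ c)) (f-onto s s∈A)

cylinder-isCube : ∀ {m k} (C : Fam m) → IsCube k C → IsCube (suc k) (cylinder C)
cylinder-isCube {m} {k} C (f , f-inj , f-∈ , f-onto , f-adj) =
  F , inj , (λ v → from (∈-cylinder C (f (init v)) (last v)) (f-∈ (init v))) , onto , adj
  where
    F : Vec Bool (suc k) → Subset (suc m)
    F v = f (init v) ∷ʳ last v
    inj : Injective _≡_ _≡_ F
    inj {u} {v} e with ∷ʳ-injective _ _ e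
    ... | fu≡fv , lu≡lv =
      trans (∷ʳ-init-last u) (trans (cong₂ _∷ʳ_ (f-inj fu≡fv) lu≡lv) (sym (∷ʳ-init-last v)))
    onto : ∀ S → S ∈F cylinder C → ∃ λ v → F v ≡ S
    onto S p with initLast S
    ... | s , l , refl with f-onto s (to (∈-cylinder C s l) p)
    ...   | w , refl = w ∷ʳ l , cong₂ _∷ʳ_ (cong f (init-∷ʳ l w)) (last-∷ʳ l w)
    adj : ∀ u v → Adj u v ⇔ Adj (F u) (F v)
    adj u v = ⇔.trans (Adj-init-last u v)
      (⇔.trans ((f-adj (init u) (init v) ×-⇔ ⇔.refl) ⊎-⇔ (mk⇔ (cong f) f-inj ×-⇔ ⇔.refl))
               (⇔.sym (Adj-∷ʳ (f (init u)) (f (init v)) (last u) (last v))))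

onto-last : ∀ {m k} {W : Fam (suc m)} {f : Vec Bool k → Subset (suc m)} {c} →
  (∀ S → S ∈F W → ∃ λ v → f v ≡ S) → (∀ v → last (f v) ≡ c) → ∀ S → S ∈F W → last S ≡ c
onto-last f-onto last≡c S p with f-onto S p
... | v , refl = last≡c v

isCube-inSlice : ∀ {m k} {W : Fam (suc m)} c → (∀ S → S ∈F W → last S ≡ c) →
  IsCube k W → slice (not c) W ≡ ∅ × IsCube k (slice c W)
isCube-inSlice {k = k} {W} c last≡c (f , f-inj , f-∈ , f-onto , f-adj) =
  slice≡∅ (not c) W outside , init ∘ f , inj , mem , onto , adj
  where
    split : ∀ v → f v ≡ init (f v) ∷ʳ c
    split v = trans (∷ʳ-init-last (f v)) (cong (init (f v) ∷ʳ_) (last≡c _ (f-∈ v)))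
    outside : ∀ s → ¬ (s ∷ʳ not c) ∈F W
    outside s p = not-¬ refl (trans (sym (last≡c _ p)) (last-∷ʳ (not c) s))
    inj : Injective _≡_ _≡_ (init ∘ f)
    inj {u} {v} e = f-inj (trans (split u) (trans (cong (_∷ʳ c) e) (sym (split v))))
    mem : ∀ v → init (f v) ∈F slice c W
    mem v = from (∈-slice c W (init (f v))) (subst (_∈F W) (split v) (f-∈ v))
    onto : ∀ s → s ∈F slice c W → ∃ λ v → init (f v) ≡ s
    onto s p = map₂ (λ e → trans (cong init e) (init-∷ʳ c s)) (f-onto _ (to (∈-slice c W s) p))
    adj : ∀ u v → Adj u v ⇔ Adj (init (f u)) (init (f v))
    adj u v = ⇔.trans (f-adj u v)
      (Adj-init-last-≡ (f u) (f v) (trans (last≡c _ (f-∈ u)) (sym (last≡c _ (f-∈ v)))))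

module Directions {m k} {W : Fam (suc m)} (f : Vec Bool (suc k) → Subset (suc m))
  (f-inj : Injective _≡_ _≡_ f) (f-∈ : ∀ v → f v ∈F W)
  (f-onto : ∀ S → S ∈F W → ∃ λ v → f v ≡ S) (f-adj : ∀ u v → Adj u v ⇔ Adj (f u) (f v)) where

  Flips : Fin (suc k) → Vec Bool k → Set
  Flips i w = last (f (insertAt w i false)) ≢ last (f (insertAt w i true))

  edge : ∀ w i {a b} → a ≢ b → Adj (f (insertAt w i a)) (f (insertAt w i b))
  edge w i a≢b = to (f-adj _ _) (from (Adj-insertAt w w i _ _) (inj₂ (refl , a≢b)))

  parallel : ∀ {u v} i a → Adj u v → Adj (f (insertAt u i a)) (f (insertAt v i a))
  parallel i a adj = to (f-adj _ _) (from (Adj-insertAt _ _ i a a) (inj₁ (adj , refl)))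

  flips-along-edge : ∀ i u v → Adj u v → Flips i u → Flips i v
  flips-along-edge i u v adj = square-lastFlip (edge u i (λ ())) (parallel i true adj)
    (parallel i false adj) (f-inj-≢ (insertAt-≢ u v i (λ ()))) (f-inj-≢ (insertAt-≢ u v i (λ ())))
    where
      f-inj-≢ : ∀ {x y} → x ≢ y → f x ≢ f y
      f-inj-≢ x≢y = x≢y ∘ f-inj

  flips-everywhere : ∀ i u v → Flips i u → Flips i v
  flips-everywhere i = hypercube-connected (Flips i) (flips-along-edge i)

  last-constant : ∀ w₀ → (∀ i → ¬ Flips i w₀) → ∀ u v → last (f u) ≡ last (f v)
  last-constant w₀ noFlip u v = hypercube-connected (λ x → last (f u) ≡ last (f x)) step u v refl
    where
      keeps : ∀ i w → last (f (insertAt w i false)) ≡ last (f (insertAt w i true))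
      keeps i w = decidable-stable (_ ≟ᵇ _) (noFlip i ∘ flips-everywhere i w w₀)
      step : ∀ x y → Adj x y → last (f u) ≡ last (f x) → last (f u) ≡ last (f y)
      step x y adj e with Adj⇒insertAt x y adj
      ... | w , i , a , b , refl , refl =
        trans e (Bool-fun-constant (λ a → last (f (insertAt w i a))) (keeps i w) a b)

  module Across (i : Fin (suc k)) (flips : ∀ w → Flips i w) where

    L : Vec Bool k → Bool → Bool
    L w a = last (f (insertAt w i a))

    g : Vec Bool k → Subset m
    g w = init (f (insertAt w i false))

    L-not : ∀ w a → L w (not a) ≡ not (L w a)
    L-not w false = ¬-not (≢-sym (flips w))
    L-not w true = ¬-not (flips w)

    L-onto : ∀ w c → ∃ λ a → L w a ≡ c
    L-onto w c with L w false ≟ᵇ c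
    ... | yes e = false , e
    ... | no ne = true , trans (L-not w false) (sym (¬-not (≢-sym ne)))

    f-split : ∀ w a → f (insertAt w i a) ≡ g w ∷ʳ L w a
    f-split w a = trans (∷ʳ-init-last _) (cong (_∷ʳ L w a) (init≡ a))
      where
        init≡ : ∀ a → init (f (insertAt w i a)) ≡ g w
        init≡ false = refl
        init≡ true = sym (Adj-init-last-≢ (edge w i (λ ())) (flips w))

    g-∷ʳ-∈ : ∀ w c → (g w ∷ʳ c) ∈F W
    g-∷ʳ-∈ w c with L-onto w c
    ... | a , refl = subst (_∈F W) (f-split w a) (f-∈ _)

    g-onto : ∀ s c → (s ∷ʳ c) ∈F W → ∃ λ w → g w ≡ s
    g-onto s c p with f-onto _ p
    ... | v , fv≡ = w , proj₁ (∷ʳ-injective _ _ (begin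
          g w ∷ʳ L w (lookup v i)            ≡⟨ sym (f-split w (lookup v i)) ⟩
          f (insertAt w i (lookup v i))      ≡⟨ cong f (insertAt-removeAt v i) ⟩
          f v                                ≡⟨ fv≡ ⟩
          s ∷ʳ c                             ∎))
      where
        open ≡-Reasoning
        w = removeAt v i

    g-inj : Injective _≡_ _≡_ g
    g-inj {w} {w′} e with L-onto w′ (L w false)
    ... | a , La≡ = insertAt-injective w w′ i (f-inj (begin
          f (insertAt w i false)    ≡⟨ f-split w false ⟩
          g w ∷ʳ L w false          ≡⟨ cong₂ _∷ʳ_ e (sym La≡) ⟩
          g w′ ∷ʳ L w′ a            ≡⟨ sym (f-split w′ a) ⟩
          f (insertAt w′ i a)       ∎))
      where open ≡-Reasoning

    g-adj : ∀ w w′ → Adj w w′ ⇔ Adj (g w) (g w′)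
    g-adj w w′ = mk⇔ forth back
      where
        forth : Adj w w′ → Adj (g w) (g w′)
        forth adj with to (Adj-init-last _ _) (parallel i false adj)
        ... | inj₁ (adj′ , _) = adj′
        ... | inj₂ (e , _) = ⊥-elim (Adj-irrefl w (subst (Adj w) (sym (g-inj e)) adj))
        image-adj : ∀ a → L w′ a ≡ L w false → Adj (g w) (g w′) →
          Adj (f (insertAt w i false)) (f (insertAt w′ i a))
        image-adj a La≡ adj′ = subst₂ Adj (sym (f-split w false)) (sym (f-split w′ a))
          (from (Adj-∷ʳ (g w) (g w′) (L w false) (L w′ a)) (inj₁ (adj′ , sym La≡)))
        back : Adj (g w) (g w′) → Adj w w′
        back adj′ with L-onto w′ (L w false)
        ... | a , La≡ with to (Adj-insertAt w w′ i false a) (from (f-adj _ _) (image-adj a La≡ adj′))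
        ...   | inj₁ (adj , _) = adj
        ...   | inj₂ (refl , _) = ⊥-elim (Adj-irrefl (g w) adj′)

    isCylinder : slice false W ≡ slice true W × IsCube k (slice false W)
    isCylinder = slices≡ W (λ s c p → closed s c p) ,
      g , g-inj , (λ w → from (∈-slice false W (g w)) (g-∷ʳ-∈ w false)) ,
      (λ s p → g-onto s false (to (∈-slice false W s) p)) , g-adj
      where
        closed : ∀ s c → (s ∷ʳ c) ∈F W → (s ∷ʳ not c) ∈F W
        closed s c p with g-onto s c p
        ... | w , refl = g-∷ʳ-∈ w (not c)

LastCoordinateShape : ∀ {m} → ℕ → Fam (suc m) → Set
LastCoordinateShape k W =
  (Σ Bool λ c → slice (not c) W ≡ ∅ × IsCube k (slice c W)) ⊎
  (Σ ℕ λ k′ → k ≡ suc k′ × slice false W ≡ slice true W × IsCube k′ (slice false W))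

isCube-lastCoordinate : ∀ {m k} {W : Fam (suc m)} → IsCube k W → LastCoordinateShape k W
isCube-lastCoordinate {k = zero} cube@(f , _ , _ , f-onto , _) =
  inj₁ (last (f []) , isCube-inSlice _ (onto-last f-onto λ { [] → refl }) cube)
isCube-lastCoordinate {k = suc k} {W} cube@(f , f-inj , f-∈ , f-onto , f-adj) =
  decide (any? λ i → ¬? (last (f (insertAt w₀ i false)) ≟ᵇ last (f (insertAt w₀ i true))))
  where
    open Directions f f-inj f-∈ f-onto f-adj
    w₀ = replicate k false
    decide : Dec (∃ λ i → Flips i w₀) → LastCoordinateShape (suc k) W
    decide (yes (i , flips)) = inj₂ (k , refl , Across.isCylinder i (λ w → flips-everywhere i w₀ w flips))
    decide (no noFlip) = inj₁ (_ , isCube-inSlice _ (onto-last f-onto λ v →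
      last-constant w₀ (λ i flips → noFlip (i , flips)) v (replicate (suc k) false)) cube)

-- Counting

Enumerates : {A : Set} → (A → Set) → ℕ → Set
Enumerates {A} Q c = Σ (List A) λ L → Unique L × (∀ x → (x ∈L L) ⇔ Q x) × length L ≡ c

Enumerates-unique : ∀ {A : Set} {Q : A → Set} {c c′} → Enumerates Q c → Enumerates Q c′ → c ≡ c′
Enumerates-unique (L , L! , L⇔ , refl) (L′ , L′! , L′⇔ , refl) =
  ↭-length (∼bag⇒↭ (unique∧set⇒bag L! L′! λ {x} → ⇔.trans (L⇔ x) (⇔.sym (L′⇔ x))))

Enumerates-resp : ∀ {A : Set} {Q Q′ : A → Set} {c} → (∀ x → Q x ⇔ Q′ x) → Enumerates Q c → Enumerates Q′ c
Enumerates-resp Q⇔Q′ (L , L! , L⇔ , len) = L , L! , (λ x → ⇔.trans (L⇔ x) (Q⇔Q′ x)) , len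

Enumerates-∅ : ∀ {A : Set} {Q : A → Set} → (∀ x → ¬ Q x) → Enumerates Q 0
Enumerates-∅ ¬Q = [] , [] , (λ x → mk⇔ (λ ()) (⊥-elim ∘ ¬Q x)) , refl

Image : {A B : Set} → (B → A) → (B → Set) → A → Set
Image e Q a = ∃ λ b → Q b × a ≡ e b

Enumerates-image : ∀ {A B : Set} {Q : B → Set} {c} (e : B → A) → Injective _≡_ _≡_ e →
  Enumerates Q c → Enumerates (Image e Q) c
Enumerates-image e e-inj (L , L! , L⇔ , len) =
  map e L , map⁺ e-inj L! ,
  (λ a → ⇔.trans (⇔.sym (↔⇒⇔ (map-∈↔ e)))
           (mk⇔ (map₂ λ {b} → map₁ (to (L⇔ b))) (map₂ λ {b} → map₁ (from (L⇔ b))))) ,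
  trans (length-map e L) len

Enumerates-⊎ : ∀ {A : Set} {Q₁ Q₂ : A → Set} {c₁ c₂} → (∀ x → Q₁ x → ¬ Q₂ x) →
  Enumerates Q₁ c₁ → Enumerates Q₂ c₂ → Enumerates (λ x → Q₁ x ⊎ Q₂ x) (c₁ + c₂)
Enumerates-⊎ disjoint (L₁ , L₁! , L₁⇔ , len₁) (L₂ , L₂! , L₂⇔ , len₂) =
  L₁ ++ L₂ , ++⁺ L₁! L₂! (λ (p , q) → disjoint _ (to (L₁⇔ _) p) (to (L₂⇔ _) q)) ,
  (λ x → ⇔.trans ++-∈⇔ (L₁⇔ x ⊎-⇔ L₂⇔ x)) , trans (length-++ L₁) (cong₂ _+_ len₁ len₂)

∃-Bool : ∀ (R : Bool → Set) c → (∃ λ c′ → R c′) ⇔ (R (not c) ⊎ R c)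
∃-Bool R c = mk⇔ forth back
  where
    forth : (∃ λ c′ → R c′) → R (not c) ⊎ R c
    forth (c′ , r) with c′ ≟ᵇ c
    ... | yes refl = inj₂ r
    ... | no c′≢c = inj₁ (subst R (¬-not c′≢c) r)
    back : R (not c) ⊎ R c → ∃ λ c′ → R c′
    back (inj₁ r) = not c , r
    back (inj₂ r) = c , r

shiftPred : {A : Set} → (ℕ → A → Set) → ℕ → A → Set
shiftPred Q zero x = ⊥
shiftPred Q (suc k) x = Q k x

Enumerates-shift : ∀ {A : Set} {Q : ℕ → A → Set} {q : ℕ → ℕ} → (∀ k → Enumerates (Q k) (q k)) →
  ∀ k → Enumerates (shiftPred Q k) (shiftX q k)
Enumerates-shift E zero = Enumerates-∅ λ _ ()
Enumerates-shift E (suc k) = E k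

AllMembers : ∀ {n} → (Subset n → Set) → Fam n → Set
AllMembers {n} P W = ∀ (S : Subset n) → S ∈F W → P S

-- InducesCube n k is IsInducedCube (IsFilter n) k, and CubeCount n k c is
-- Enumerates (IsInducedCube (IsFilter n) k) c.
IsInducedCube : ∀ {n} → (Subset n → Set) → ℕ → Fam n → Set
IsInducedCube P k W = AllMembers P W × IsCube k W

Slice : ∀ {m} → (Subset (suc m) → Set) → Bool → Subset m → Set
Slice P c s = P (s ∷ʳ c)

EverySlice : ∀ {m} → (Subset (suc m) → Set) → Subset m → Set
EverySlice P s = ∀ c → P (s ∷ʳ c)

isInducedCube⇒∃ : ∀ {n k} {P : Subset n → Set} {W} → IsInducedCube P k W → ∃ P
isInducedCube⇒∃ {k = k} (P-W , f , _ , f-∈ , _) = f v₀ , P-W (f v₀) (f-∈ v₀)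
  where v₀ = replicate k false

isInducedCube-resp : ∀ {n k} {P P′ : Subset n → Set} → (∀ S → P S ⇔ P′ S) →
  ∀ W → IsInducedCube P k W ⇔ IsInducedCube P′ k W
isInducedCube-resp P⇔P′ W = mk⇔
  (map₁ λ P-W S p → to (P⇔P′ S) (P-W S p))
  (map₁ λ P′-W S p → from (P⇔P′ S) (P′-W S p))

Enumerates-cubes-resp : ∀ {n k c} {P P′ : Subset n → Set} → (∀ S → P S ⇔ P′ S) →
  Enumerates (IsInducedCube P k) c → Enumerates (IsInducedCube P′ k) c
Enumerates-cubes-resp P⇔P′ = Enumerates-resp (isInducedCube-resp P⇔P′)

shiftCube⇒≢∅ : ∀ {n} {Q : Subset n → Set} k {C} → shiftPred (IsInducedCube Q) k C → C ≢ ∅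
shiftCube⇒≢∅ (suc k) (_ , cube) = isCube⇒≢∅ cube

module _ {m} (P : Subset (suc m) → Set) where

  allMembers-slice : ∀ c W → AllMembers P W → AllMembers (Slice P c) (slice c W)
  allMembers-slice c W P-W s p = P-W _ (to (∈-slice c W s) p)

  allMembers-embed : ∀ c A → AllMembers (Slice P c) A → AllMembers P (embed c A)
  allMembers-embed c A P-A S p with initLast S
  ... | s , l , refl with ∈-embed⁻ c A s l p
  ...   | refl , s∈A = P-A s s∈A

  allMembers-cylinder : ∀ C → AllMembers (EverySlice P) C → AllMembers P (cylinder C)
  allMembers-cylinder C P-C S p with initLast S
  ... | s , l , refl = P-C s (to (∈-cylinder C s l) p) l

  allMembers-slices : ∀ W → slice false W ≡ slice true W → AllMembers P W →
    AllMembers (EverySlice P) (slice false W)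
  allMembers-slices W eq P-W s p c = P-W _ (to (∈-slice c W s) (subst (s ∈F_) (slice-false≡ c) p))
    where
      slice-false≡ : ∀ c → slice false W ≡ slice c W
      slice-false≡ false = refl
      slice-false≡ true = eq

  SliceCube : ℕ → Bool → Fam (suc m) → Set
  SliceCube k c = Image (embed c) (IsInducedCube (Slice P c) k)

  CylinderCube : ℕ → Fam (suc m) → Set
  CylinderCube k = Image cylinder (shiftPred (IsInducedCube (EverySlice P)) k)

  isInducedCube-lastCoordinate : ∀ k (W : Fam (suc m)) →
    IsInducedCube P k W ⇔ ((∃ λ c → SliceCube k c W) ⊎ CylinderCube k W)
  isInducedCube-lastCoordinate k W = mk⇔ forth (back k)
    where
      forth : IsInducedCube P k W → (∃ λ c → SliceCube k c W) ⊎ CylinderCube k W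
      forth (P-W , cube) with isCube-lastCoordinate cube
      ... | inj₁ (c , empty , cube′) =
        inj₁ (c , slice c W , (allMembers-slice c W P-W , cube′) , sym (embed-slice c W empty))
      ... | inj₂ (k′ , refl , eq , cube′) =
        inj₂ (slice false W , (allMembers-slices W eq P-W , cube′) , sym (cylinder-slice W eq))
      back : ∀ k → (∃ λ c → SliceCube k c W) ⊎ CylinderCube k W → IsInducedCube P k W
      back k (inj₁ (c , A , (P-A , cube) , refl)) = allMembers-embed c A P-A , embed-isCube c A cube
      back (suc k) (inj₂ (C , (P-C , cube) , refl)) = allMembers-cylinder C P-C , cylinder-isCube C cube

  Enumerates-cubes-∷ʳ : ∀ c k {c₀ c₁ c₂} →
    Enumerates (IsInducedCube (Slice P (not c)) k) c₀ → Enumerates (IsInducedCube (Slice P c) k) c₁ →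
    Enumerates (shiftPred (IsInducedCube (EverySlice P)) k) c₂ →
    Enumerates (IsInducedCube P k) (c₀ + c₁ + c₂)
  Enumerates-cubes-∷ʳ c k E₀ E₁ E₂ =
    Enumerates-resp (λ W → ⇔.sym (⇔.trans (isInducedCube-lastCoordinate k W) (∃-Bool _ c ⊎-⇔ ⇔.refl)))
      (Enumerates-⊎ notCylinder
        (Enumerates-⊎ (λ _ → different-slices)
          (Enumerates-image (embed (not c)) (embed-injective (not c)) E₀)
          (Enumerates-image (embed c) (embed-injective c) E₁))
        (Enumerates-image cylinder cylinder-injective E₂))
    where
      different-slices : ∀ {W} → SliceCube k (not c) W → ¬ SliceCube k c W
      different-slices (A , _ , refl) (B , (_ , cube) , e) = embed-not≢embed c A B (isCube⇒≢∅ cube) e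
      notCylinder : ∀ W → SliceCube k (not c) W ⊎ SliceCube k c W → ¬ CylinderCube k W
      notCylinder W (inj₁ (A , _ , e)) (C , ic , refl) = embed≢cylinder (not c) A C (shiftCube⇒≢∅ k ic) (sym e)
      notCylinder W (inj₂ (A , _ , e)) (C , ic , refl) = embed≢cylinder c A C (shiftCube⇒≢∅ k ic) (sym e)

  Enumerates-cubes-inSlice : ∀ c k {n} → (∀ s → ¬ P (s ∷ʳ not c)) →
    Enumerates (IsInducedCube (Slice P c) k) n → Enumerates (IsInducedCube P k) n
  Enumerates-cubes-inSlice c k {n} ¬P E = subst (Enumerates _) (+-identityʳ n)
    (Enumerates-cubes-∷ʳ c k (Enumerates-∅ λ _ ic → ¬P _ (proj₂ (isInducedCube⇒∃ ic))) E
      (Enumerates-∅ (noCylinder k)))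
    where
      noCylinder : ∀ k C → ¬ shiftPred (IsInducedCube (EverySlice P)) k C
      noCylinder (suc k) C ic with isInducedCube⇒∃ ic
      ... | s , every = ¬P s (every (not c))

-- Filters of the S-fence

-- CovToward b i j: x_j is a cover neighbour of x_i on the side (above for b = true, below for
-- b = false) to which filter membership b of x_i propagates.
CovToward : Bool → ℕ → ℕ → Set
CovToward true i j = Cov i j
CovToward false i j = Cov j i

UpClosed : (n : ℕ) → Subset n → Set
UpClosed n S = ∀ x y → CovF n x y → lookup S x ≡ true → lookup S y ≡ true

isFilter⇔upClosed : ∀ n (S : Subset n) → IsFilter n S ⇔ UpClosed n S
isFilter⇔upClosed n S = mk⇔
  (λ filter x y c x∈S → []=⇒lookup (filter x y (c ◅ ε) (lookup⇒[]= x S x∈S)))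
  (λ up x y path x∈S → lookup⇒[]= y S (along up path ([]=⇒lookup x∈S)))
  where
    along : ∀ {x y} → UpClosed n S → Star (CovF n) x y → lookup S x ≡ true → lookup S y ≡ true
    along up ε x∈S = x∈S
    along up (c ◅ path) x∈S = along up path (up _ _ c x∈S)

lookup-∷ʳ-inject₁ : ∀ {A : Set} {m} (s : Vec A m) a x → lookup (s ∷ʳ a) (inject₁ x) ≡ lookup s x
lookup-∷ʳ-inject₁ (b ∷ s) a zero = refl
lookup-∷ʳ-inject₁ (b ∷ s) a (suc x) = lookup-∷ʳ-inject₁ s a x

lookup-∷ʳ-fromℕ : ∀ {A : Set} {m} (s : Vec A m) a → lookup (s ∷ʳ a) (fromℕ m) ≡ a
lookup-∷ʳ-fromℕ [] a = refl
lookup-∷ʳ-fromℕ (b ∷ s) a = lookup-∷ʳ-fromℕ s a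

module _ {m} (s : Subset m) where

  TopNeighbours : Bool → Set
  TopNeighbours b = ∀ x → CovToward b (suc m) (suc (toℕ x)) → lookup s x ≡ b

  private
    index-inject₁ : ∀ (x : Fin m) → suc (toℕ (inject₁ x)) ≡ suc (toℕ x)
    index-inject₁ x = cong (1 +_) (toℕ-inject₁ x)

    index-fromℕ : suc (toℕ (fromℕ m)) ≡ suc m
    index-fromℕ = cong (1 +_) (toℕ-fromℕ m)

    into-top : ∀ b x → Cov (suc (toℕ x)) (suc m) → TopNeighbours b → lookup s x ≡ true → b ≡ true
    into-top true x c nb x∈s = refl
    into-top false x c nb x∈s = trans (sym (nb x c)) x∈s

    out-of-top : ∀ b y → Cov (suc m) (suc (toℕ y)) → TopNeighbours b → b ≡ true → lookup s y ≡ true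
    out-of-top true y c nb _ = nb y c

  upClosed-∷ʳ⁻ : ∀ b → UpClosed (suc m) (s ∷ʳ b) → UpClosed m s × TopNeighbours b
  upClosed-∷ʳ⁻ b up = lower , neighbours b up
    where
      lower : UpClosed m s
      lower x y c x∈s = trans (sym (lookup-∷ʳ-inject₁ s b y))
        (up _ _ (subst₂ Cov (sym (index-inject₁ x)) (sym (index-inject₁ y)) c)
                (trans (lookup-∷ʳ-inject₁ s b x) x∈s))
      neighbours : ∀ b → UpClosed (suc m) (s ∷ʳ b) → TopNeighbours b
      neighbours true up x c = trans (sym (lookup-∷ʳ-inject₁ s true x))
        (up _ _ (subst₂ Cov (sym index-fromℕ) (sym (index-inject₁ x)) c) (lookup-∷ʳ-fromℕ s true))
      neighbours false up x c with lookup s x in x∈s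
      ... | false = refl
      ... | true = sym (trans (sym (lookup-∷ʳ-fromℕ s false))
        (up _ _ (subst₂ Cov (sym (index-inject₁ x)) (sym index-fromℕ) c)
                (trans (lookup-∷ʳ-inject₁ s false x) x∈s)))

  upClosed-∷ʳ⁺ : ∀ b → UpClosed m s → TopNeighbours b → UpClosed (suc m) (s ∷ʳ b)
  upClosed-∷ʳ⁺ b up nb x y c x∈s with view x | view y
  ... | ‵inject₁ x | ‵inject₁ y = trans (lookup-∷ʳ-inject₁ s b y)
    (up x y (subst₂ Cov (index-inject₁ x) (index-inject₁ y) c) (trans (sym (lookup-∷ʳ-inject₁ s b x)) x∈s))
  ... | ‵inject₁ x | ‵fromℕ = trans (lookup-∷ʳ-fromℕ s b)
    (into-top b x (subst₂ Cov (index-inject₁ x) index-fromℕ c) nb (trans (sym (lookup-∷ʳ-inject₁ s b x)) x∈s))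
  ... | ‵fromℕ | ‵inject₁ y = trans (lookup-∷ʳ-inject₁ s b y)
    (out-of-top b y (subst₂ Cov index-fromℕ (index-inject₁ y) c) nb (trans (sym (lookup-∷ʳ-fromℕ s b)) x∈s))
  ... | ‵fromℕ | ‵fromℕ = x∈s

  isFilter-∷ʳ : ∀ b → IsFilter (suc m) (s ∷ʳ b) ⇔ (IsFilter m s × TopNeighbours b)
  isFilter-∷ʳ b = mk⇔
    (λ filter → map₁ (from (isFilter⇔upClosed m s))
                  (upClosed-∷ʳ⁻ b (to (isFilter⇔upClosed (suc m) _) filter)))
    (λ (filter , nb) → from (isFilter⇔upClosed (suc m) _)
                  (upClosed-∷ʳ⁺ b (to (isFilter⇔upClosed m s) filter) nb))

isFilter-∷ʳ-free : ∀ {m} (s : Subset m) b → (∀ {j} → ¬ CovToward b (suc m) j) →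
  IsFilter (suc m) (s ∷ʳ b) ⇔ IsFilter m s
isFilter-∷ʳ-free s b free = mk⇔
  (proj₁ ∘ to (isFilter-∷ʳ s b)) (λ filter → from (isFilter-∷ʳ s b) (filter , λ x c → ⊥-elim (free c)))

isFilter-∷ʳ-leaf : ∀ {p} (s : Subset (suc p)) b →
  (∀ {j} → CovToward b (2 + p) j → j ≡ suc p ⊎ j ≡ 3 + p) → CovToward b (2 + p) (suc p) →
  IsFilter (2 + p) (s ∷ʳ b) ⇔ (IsFilter (suc p) s × lookup s (fromℕ p) ≡ b)
isFilter-∷ʳ-leaf {p} s b leaf edge = mk⇔
  (λ filter → map₂ (λ nb → nb (fromℕ p) (subst (CovToward b (2 + p)) (sym index) edge))
                (to (isFilter-∷ʳ s b) filter))
  (λ (filter , top≡b) → from (isFilter-∷ʳ s b) (filter , λ x c → subst (λ y → lookup s y ≡ b) (sym (only x c)) top≡b))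
  where
    index : suc (toℕ (fromℕ p)) ≡ suc p
    index = cong (1 +_) (toℕ-fromℕ p)
    only : ∀ x → CovToward b (2 + p) (suc (toℕ x)) → x ≡ fromℕ p
    only x c with leaf c
    ... | inj₁ e = toℕ-injective (trans (suc-injective e) (sym (toℕ-fromℕ p)))
    ... | inj₂ e = ⊥-elim (<⇒≱ (toℕ<n x) (subst (suc p ≤_) (sym (suc-injective e)) (n≤1+n (suc p))))

-- In φ_{p+2}, x_{p+1} is the only neighbour of x_{p+2} and lies on its side b (top-leaf also
-- allows x_{p+3}, which is outside φ_{p+2}); in φ_{p+1}, x_{p+1} has no neighbour on side b.
record LeafAtTop (b : Bool) (p : ℕ) : Set where
  field
    top-free : ∀ {j} → ¬ CovToward (not b) (2 + p) j
    top-leaf : ∀ {j} → CovToward b (2 + p) j → j ≡ suc p ⊎ j ≡ 3 + p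
    top-edge : CovToward b (2 + p) (suc p)
    below-free : ∀ {j} → ¬ CovToward b (suc p) j

cubePoly-recurrence : ∀ {b p} → LeafAtTop b p → ∀ {q q₁ q₂} →
  IsCubePoly (2 + p) q → IsCubePoly (1 + p) q₁ → IsCubePoly p q₂ →
  ∀ k → q k ≡ q₁ k + q₂ k + shiftX q₂ k
cubePoly-recurrence {b} {p} leaf {q₂ = q₂} hq hq₁ hq₂ k =
  Enumerates-unique (hq k)
    (Enumerates-cubes-∷ʳ P b k (Enumerates-cubes-resp off-top (hq₁ k)) (top-cubes k)
      (Enumerates-shift (λ k → Enumerates-cubes-resp on-top⇔every (top-cubes k)) k))
  where
    open LeafAtTop leaf
    P : Subset (2 + p) → Set
    P = IsFilter (2 + p)
    off-top : ∀ s → IsFilter (1 + p) s ⇔ Slice P (not b) s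
    off-top s = ⇔.sym (isFilter-∷ʳ-free s (not b) top-free)
    on-top : ∀ s → Slice P b s ⇔ (IsFilter (1 + p) s × lookup s (fromℕ p) ≡ b)
    on-top s = isFilter-∷ʳ-leaf s b top-leaf top-edge
    on-top⇔every : ∀ s → Slice P b s ⇔ EverySlice P s
    on-top⇔every s = mk⇔ (λ on c → every c on) (λ every → every b)
      where
        every : ∀ c → Slice P b s → P (s ∷ʳ c)
        every c on with c ≟ᵇ b
        ... | yes refl = on
        ... | no c≢b = subst (λ c → Slice P c s) (sym (¬-not c≢b)) (to (off-top s) (proj₁ (to (on-top s) on)))
    not-on-top : ∀ s → ¬ Slice P b (s ∷ʳ not b)
    not-on-top s on = not-¬ refl (sym (trans (sym (lookup-∷ʳ-fromℕ s (not b))) (proj₂ (to (on-top _) on))))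
    below-top : ∀ s → IsFilter p s ⇔ Slice (Slice P b) b s
    below-top s = mk⇔
      (λ filter → from (on-top _) (from (isFilter-∷ʳ-free s b below-free) filter , lookup-∷ʳ-fromℕ s b))
      (λ on → to (isFilter-∷ʳ-free s b below-free) (proj₁ (to (on-top _) on)))
    top-cubes : ∀ k → Enumerates (IsInducedCube (Slice P b) k) (q₂ k)
    top-cubes k = Enumerates-cubes-inSlice (Slice P b) b k not-on-top (Enumerates-cubes-resp below-top (hq₂ k))

parity : ∀ r → ∃ λ t → r ≡ 2 * t ⊎ r ≡ suc (2 * t)
parity zero = 0 , inj₁ refl
parity (suc r) with parity r
... | t , inj₁ refl = t , inj₂ refl
... | t , inj₂ refl = suc t , inj₁ (sym (*-suc 2 t))

¬Cov-into-odd : ∀ t {i} → ¬ Cov i (5 + 2 * t)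
¬Cov-into-odd t c = go c refl
  where
    go : ∀ {i j} → Cov i j → j ≡ 5 + 2 * t → ⊥
    go (cA u) e = even≢odd t u (sym (cong (_∸ 5) e))
    go (cB u) e = even≢odd t u (sym (cong (_∸ 5) e))

¬Cov-out-of-even : ∀ t {j} → ¬ Cov (4 + 2 * t) j
¬Cov-out-of-even t c = go c refl
  where
    go : ∀ {i j} → Cov i j → i ≡ 4 + 2 * t → ⊥
    go c54 e = even≢odd t 0 (sym (cong (_∸ 4) e))
    go (cA u) e = even≢odd t u (sym (cong (_∸ 4) e))
    go (cB u) e = even≢odd t (suc u) (sym (trans (cong suc (*-suc 2 u)) (cong (_∸ 4) e)))

Cov-out-of-odd : ∀ t {j} → Cov (5 + 2 * t) j → j ≡ 4 + 2 * t ⊎ j ≡ 6 + 2 * t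
Cov-out-of-odd t c = go c refl
  where
    go : ∀ {i j} → Cov i j → i ≡ 5 + 2 * t → j ≡ 4 + 2 * t ⊎ j ≡ 6 + 2 * t
    go c54 e = inj₁ (cong pred e)
    go (cA u) e = inj₂ (cong suc e)
    go (cB u) e = inj₁ (cong pred e)

Cov-into-even : ∀ t {i} → Cov i (6 + 2 * t) → i ≡ 5 + 2 * t ⊎ i ≡ 7 + 2 * t
Cov-into-even t c = go c refl
  where
    go : ∀ {i j} → Cov i j → j ≡ 6 + 2 * t → i ≡ 5 + 2 * t ⊎ i ≡ 7 + 2 * t
    go (cA u) e = inj₁ (cong pred e)
    go (cB u) e = inj₂ (cong suc e)

Cov-odd-even : ∀ t → Cov (5 + 2 * t) (4 + 2 * t)
Cov-odd-even zero = c54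
Cov-odd-even (suc t) = subst₂ Cov (cong (5 +_) (sym (*-suc 2 t))) (cong (4 +_) (sym (*-suc 2 t))) (cB t)

sFence-leafAtTop : ∀ r → ∃ λ b → LeafAtTop b (3 + r)
sFence-leafAtTop r with parity r
... | t , inj₁ refl = true , record
  { top-free = ¬Cov-into-odd t
  ; top-leaf = Cov-out-of-odd t
  ; top-edge = Cov-odd-even t
  ; below-free = ¬Cov-out-of-even t
  }
... | t , inj₂ refl = false , record
  { top-free = λ {j} → ¬Cov-out-of-even (suc t) ∘ subst (λ i → Cov i j) (cong (4 +_) (sym (*-suc 2 t)))
  ; top-leaf = Cov-into-even t
  ; top-edge = cA t
  ; below-free = ¬Cov-into-odd t
  }

proposition4 : ∀ (n : ℕ) → 5 ≤ n → ∀ (q q₁ q₂ : ℕ → ℕ) →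
    IsCubePoly n q → IsCubePoly (n ∸ 1) q₁ → IsCubePoly (n ∸ 2) q₂ →
    ∀ k → q k ≡ q₁ k + q₂ k + shiftX q₂ k
proposition4 n 5≤n q q₁ q₂ with m≤n⇒∃[o]m+o≡n 5≤n
... | r , refl with sFence-leafAtTop r
...   | b , leaf = cubePoly-recurrence leaf
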